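{- Fix integers $n\ge 0$ and $g\ge 0$. There is a bijection from the set of ordered rooted trees $T$ with $n+1$ vertices satisfying $\max_{0\le i<n}\operatorname{dist}_T(i,i+1)\le g+1$ to the set of quadruples $(m,L,R,M)$ such that \begin{itemize} \item $m$ is a non-negative integer, \item $L=(L_1,\dots,L_m)$ is an $m$-tuple of ordered rooted trees of depth at most $\lfloor g/2\rfloor$, \item $R=(R_1,\dots,R_m)$ is an $m$-tuple of ordered rooted trees of depth at most $\lceil g/2\rceil$, \item $M$ is an ordered rooted tree of depth at most $\lceil g/2\rceil$ if $m=0$, and of depth exactly $\lceil g/2\rceil$ otherwise, \end{itemize} and the total number of vertices of the trees $L_1,\dots,L_m,R_1,\dots,R_m,M$ is $n+1+m$.
   Context: An ordered rooted tree is an unlabeled rooted tree together with a linear order on the children of each vertex; its depth is the maximal number of edges on a path from the root to a vertex. An ordered rooted tree $T$ with $n+1$ vertices is labeled by $\{0,\dots,n\}$ via its natural labeling: the unique labeling such that every vertex has a smaller label than its parent, for every $i<n$ the labels of all children of $i$ are smaller than those of all children of $i+1$, and the children of each vertex are labeled increasingly in their given order. $\operatorname{dist}_T(i,j)$ is the number of edges on the path between the vertices labeled $i$ and $j$. -}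

module Defs where

open import Data.Nat using (ℕ; zero; suc; _+_; _*_; _∸_; _⊔_; _≤_; ⌊_/2⌋; ⌈_/2⌉)
open import Data.List using (List; []; _∷_; _++_; map; concat; length; reverse; upTo)
open import Data.List.Relation.Unary.All using (All)
open import Data.Vec as Vec using (Vec)
open import Data.Vec.Relation.Unary.All as VAll using ()
import Data.Nat
import Relation.Nullary
open import Data.Product using (Σ; _×_)
open import Relation.Binary.PropositionalEquality using (_≡_)

data Tree : Set where
  node : List Tree → Tree

mutual
  size : Tree → ℕ
  size (node ts) = suc (sizeF ts)

  sizeF : List Tree → ℕ
  sizeF []       = 0
  sizeF (t ∷ ts) = size t + sizeF ts

mutual
  depth : Tree → ℕ
  depth (node ts) = depthF ts

  depthF : List Tree → ℕ
  depthF []       = 0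
  depthF (t ∷ ts) = suc (depth t) ⊔ depthF ts

-- A vertex is addressed by its path from the root: list of child indices.
Path : Set
Path = List ℕ

mutual
  atDepth : ℕ → Tree → List Path
  atDepth zero    t         = [] ∷ []
  atDepth (suc d) (node ts) = atDepthF d 0 ts

  atDepthF : ℕ → ℕ → List Tree → List Path
  atDepthF d k []       = []
  atDepthF d k (t ∷ ts) = map (k ∷_) (atDepth d t) ++ atDepthF d (suc k) ts

-- Vertices in order of increasing natural label: the natural labeling puts
-- the root at n, its children (left to right) at the next-largest block,
-- and in general depth-(d+1) vertices below all depth-d ones, each level
-- labeled increasingly from left to right. Hence: deepest level first,
-- each level left to right.
labelOrder : Tree → List Path
labelOrder t = concat (map (λ d → atDepth d t) (reverse (upTo (suc (depth t)))))

nth : List Path → ℕ → Path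
nth []       _       = []
nth (p ∷ ps) zero    = p
nth (p ∷ ps) (suc i) = nth ps i

vertex : Tree → ℕ → Path
vertex t i = nth (labelOrder t) i

lcp : Path → Path → ℕ
lcp (a ∷ p) (b ∷ q) with a Data.Nat.≟ b
... | Relation.Nullary.yes _ = suc (lcp p q)
... | Relation.Nullary.no  _ = 0
lcp _ _ = 0

dist : Tree → ℕ → ℕ → ℕ
dist t i j = length p + length q ∸ 2 * lcp p q
  where
    p = vertex t i
    q = vertex t j

TreesND : ℕ → ℕ → Set
TreesND n g = Σ Tree (λ T → (size T ≡ suc n) ×
                            All (λ i → dist T i (suc i) ≤ suc g) (upTo n))

MCond : ℕ → ℕ → Tree → Set
MCond g zero    M = depth M ≤ ⌈ g /2⌉
MCond g (suc _) M = depth M ≡ ⌈ g /2⌉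

totalSize : {m : ℕ} → Vec Tree m → ℕ
totalSize v = Vec.sum (Vec.map size v)

Quadruples : ℕ → ℕ → Set
Quadruples n g =
  Σ ℕ (λ m → Σ (Vec Tree m) (λ L → Σ (Vec Tree m) (λ R → Σ Tree (λ M →
     VAll.All (λ t → depth t ≤ ⌊ g /2⌋) L ×
     VAll.All (λ t → depth t ≤ ⌈ g /2⌉) R ×
     MCond g m M ×
     (totalSize L + totalSize R + size M ≡ n + 1 + m)))))

module Submission where

-- Let f = ⌊g/2⌋ and c = ⌈g/2⌉. In label order the vertices come level by level, deepest level first
-- and each level from left to right; call a tree admissible if consecutive vertices of this list
-- are at distance ≤ g + 1. Two vertices of depth ≤ c are at distance ≤ 2c ≤ g + 1, so every tree of
-- depth ≤ c is admissible. In a deeper tree, consecutive vertices of depth c + 1 below different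
-- children of the root are at distance 2c + 2 > g + 1; hence all vertices of depth > c lie below
-- one child S, the subtrees right of S have depth < c, and (looking at the step of length 2c + 1
-- from depth c + 1 to depth c) those left of S have depth < f. Conversely such a tree is admissible
-- iff S is, since its vertices of depth > c are those of S of depth ≥ c, in the same order.
-- Iterating writes every admissible tree uniquely as glue m L R M, the left and right siblings
-- along the spine forming L and R; each step identifies the roots of Lᵢ and Rᵢ, which accounts for
-- the m in the size equation.

open import Defs
open import Data.Nat
  using (ℕ; zero; suc; _+_; _*_; _∸_; _⊔_; _≤_; _<_; z≤n; s≤s; z<s; s<s; ⌊_/2⌋; ⌈_/2⌉; _≟_; _≤?_)
open import Data.Nat.Properties
open import Data.Nat.Tactic.RingSolver using (solve-∀)
open import Data.List using (List; []; _∷_; _++_; map; concat; length; upTo; downFrom; last; head)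
open import Data.List.Properties
  using (length-++; length-map; map-++; ++-assoc; ++-identityʳ; reverse-upTo; last-map; ∷-injective; ∷-injectiveˡ)
open import Data.List.Relation.Unary.All as All using (All; []; _∷_)
import Data.List.Relation.Unary.All.Properties as AllP
open import Data.List.Relation.Unary.Linked as Linked using (Linked; []; [-]; _∷_)
import Data.List.Relation.Unary.Linked.Properties as LinkedP
open import Data.Maybe as Maybe using (just)
open import Data.Maybe.Relation.Binary.Connected
  using (Connected; just; nothing; just-nothing; nothing-just; drop-just)
open import Data.Vec using (Vec; []; _∷_)
import Data.Vec.Relation.Unary.All as VAll
open import Data.Product using (∃; _×_; _,_; proj₁; proj₂)
open import Data.Sum using (_⊎_; inj₁; inj₂)
open import Data.Empty using (⊥-elim)
open import Relation.Nullary using (yes; no; Irrelevant)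
open import Relation.Binary.PropositionalEquality
open import Function.Bundles using (_⤖_; mk⤖)
open import Function.Definitions using (Injective; Surjective)
open import Function.Construct.Symmetry using (⤖-sym)

-- Paths and forests

pathDist : Path → Path → ℕ
pathDist p q = length p + length q ∸ 2 * lcp p q

pathDist≤length+length : ∀ p q → pathDist p q ≤ length p + length q
pathDist≤length+length p q = m∸n≤m (length p + length q) (2 * lcp p q)

pathDist-∷ : ∀ k p q → pathDist (k ∷ p) (k ∷ q) ≡ pathDist p q
pathDist-∷ k p q with k ≟ k
... | no k≢k = ⊥-elim (k≢k refl)
... | yes _ rewrite +-suc (length p) (length q) | +-suc (lcp p q) (lcp p q + 0) = refl

pathDist-∷-≢ : ∀ {i k} p q → i ≢ k → pathDist (i ∷ p) (k ∷ q) ≡ suc (length p) + suc (length q)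
pathDist-∷-≢ {i} {k} p q i≢k with i ≟ k
... | yes i≡k = ⊥-elim (i≢k i≡k)
... | no _    = refl

m≤n⊔o⇒n<m⇒m≤o : ∀ {m} n o → m ≤ n ⊔ o → n < m → m ≤ o
m≤n⊔o⇒n<m⇒m≤o n o m≤n⊔o n<m with ≤-total n o
... | inj₁ n≤o rewrite m≤n⇒m⊔n≡n n≤o = m≤n⊔o
... | inj₂ o≤n rewrite m≥n⇒m⊔n≡m o≤n = ⊥-elim (<⇒≱ n<m m≤n⊔o)

⌈n/2⌉≡⌊n/2⌋⊎1+⌊n/2⌋ : ∀ n → ⌈ n /2⌉ ≡ ⌊ n /2⌋ ⊎ ⌈ n /2⌉ ≡ suc ⌊ n /2⌋
⌈n/2⌉≡⌊n/2⌋⊎1+⌊n/2⌋ zero          = inj₁ refl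
⌈n/2⌉≡⌊n/2⌋⊎1+⌊n/2⌋ (suc zero)    = inj₂ refl
⌈n/2⌉≡⌊n/2⌋⊎1+⌊n/2⌋ (suc (suc n)) with ⌈n/2⌉≡⌊n/2⌋⊎1+⌊n/2⌋ n
... | inj₁ e = inj₁ (cong suc e)
... | inj₂ e = inj₂ (cong suc e)

depthF-++ : ∀ xs ys → depthF (xs ++ ys) ≡ depthF xs ⊔ depthF ys
depthF-++ []       ys = refl
depthF-++ (x ∷ xs) ys rewrite depthF-++ xs ys = sym (⊔-assoc (suc (depth x)) (depthF xs) (depthF ys))

sizeF-++ : ∀ xs ys → sizeF (xs ++ ys) ≡ sizeF xs + sizeF ys
sizeF-++ []       ys = refl
sizeF-++ (x ∷ xs) ys rewrite sizeF-++ xs ys = sym (+-assoc (size x) (sizeF xs) (sizeF ys))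

node-injective : ∀ {xs ys} → node xs ≡ node ys → xs ≡ ys
node-injective refl = refl

depth-spine : ∀ {c} ls S rs → depthF ls ≤ c → depthF rs ≤ c → c ≤ depth S →
              depth (node (ls ++ S ∷ rs)) ≡ suc (depth S)
depth-spine ls S rs hl hr hS
  rewrite depthF-++ ls (S ∷ rs)
        | m≥n⇒m⊔n≡m {suc (depth S)} {depthF rs} (≤-trans hr (m≤n⇒m≤1+n hS))
  = m≤n⇒m⊔n≡n (≤-trans hl (m≤n⇒m≤1+n hS))

depth<depth-node : ∀ ls S rs → depth S < depth (node (ls ++ S ∷ rs))
depth<depth-node ls S rs = subst (suc (depth S) ≤_) (sym (depthF-++ ls (S ∷ rs)))
  (m≤n⇒m≤o⊔n (depthF ls) (m≤m⊔n (suc (depth S)) (depthF rs)))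

findSpine : ∀ {c} ts → suc c ≤ depthF ts →
            ∃ λ ls → ∃ λ S → ∃ λ rs → ts ≡ ls ++ S ∷ rs × depthF ls ≤ c × c ≤ depth S
findSpine {c} (t ∷ ts) h with c ≤? depth t
... | yes c≤t = [] , t , ts , refl , z≤n , c≤t
... | no  c≰t with findSpine ts (m≤n⊔o⇒n<m⇒m≤o (suc (depth t)) (depthF ts) h (s≤s (≰⇒> c≰t)))
...   | ls , S , rs , refl , hl , hS = t ∷ ls , S , rs , refl , ⊔-lub (≰⇒> c≰t) hl , hS

spine-unique : ∀ {c} ls S rs ls′ S′ rs′ →
               depthF ls ≤ c → depthF ls′ ≤ c → c ≤ depth S → c ≤ depth S′ →
               ls ++ S ∷ rs ≡ ls′ ++ S′ ∷ rs′ → ls ≡ ls′ × S ≡ S′ × rs ≡ rs′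
spine-unique [] S rs [] S′ rs′ _ _ _ _ e with ∷-injective e
... | refl , refl = refl , refl , refl
spine-unique [] S rs (l′ ∷ ls′) S′ rs′ _ hl′ hS _ e =
  ⊥-elim (<⇒≱ (m⊔n≤o⇒m≤o (suc (depth l′)) (depthF ls′) hl′)
              (subst (λ t → _ ≤ depth t) (∷-injectiveˡ e) hS))
spine-unique (l ∷ ls) S rs [] S′ rs′ hl _ _ hS′ e =
  ⊥-elim (<⇒≱ (m⊔n≤o⇒m≤o (suc (depth l)) (depthF ls) hl)
              (subst (λ t → _ ≤ depth t) (sym (∷-injectiveˡ e)) hS′))
spine-unique (l ∷ ls) S rs (l′ ∷ ls′) S′ rs′ hl hl′ hS hS′ e with ∷-injective e
... | refl , e′
  with spine-unique ls S rs ls′ S′ rs′ (m⊔n≤o⇒n≤o (suc (depth l)) _ hl) (m⊔n≤o⇒n≤o (suc (depth l)) _ hl′) hS hS′ e′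
...   | refl , refl , refl = refl , refl , refl

data NonEmpty {A : Set} : List A → Set where
  nonEmpty : ∀ x xs → NonEmpty (x ∷ xs)

module _ {A : Set} where

  NonEmpty-++ˡ : ∀ {xs : List A} ys → NonEmpty xs → NonEmpty (xs ++ ys)
  NonEmpty-++ˡ ys (nonEmpty x xs) = nonEmpty x (xs ++ ys)

  NonEmpty-++ʳ : ∀ (xs : List A) {ys} → NonEmpty ys → NonEmpty (xs ++ ys)
  NonEmpty-++ʳ []       ne = ne
  NonEmpty-++ʳ (x ∷ xs) _  = nonEmpty x _

  NonEmpty-map : ∀ {B : Set} (h : A → B) {xs} → NonEmpty xs → NonEmpty (map h xs)
  NonEmpty-map h (nonEmpty x xs) = nonEmpty (h x) (map h xs)

  last-++ : ∀ (xs : List A) {ys} → NonEmpty ys → last (xs ++ ys) ≡ last ys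
  last-++ []                _                = refl
  last-++ (x ∷ [])          (nonEmpty y ys) = refl
  last-++ (x ∷ xs@(_ ∷ _)) ne               = last-++ xs ne

  head-++ : ∀ {xs : List A} ys → NonEmpty xs → head (xs ++ ys) ≡ head xs
  head-++ ys (nonEmpty x xs) = refl

  All-last : ∀ {P : A → Set} {xs} → All P xs → NonEmpty xs → ∃ λ x → last xs ≡ just x × P x
  All-last (px ∷ [])       (nonEmpty x [])      = x , refl , px
  All-last (_ ∷ py ∷ pxs) (nonEmpty _ (y ∷ ys)) = All-last (py ∷ pxs) (nonEmpty y ys)

  All-head : ∀ {P : A → Set} {xs} → All P xs → NonEmpty xs → ∃ λ x → head xs ≡ just x × P x
  All-head (px ∷ _) (nonEmpty x _) = x , refl , px

  Linked-++⁻ : ∀ {R : A → A → Set} xs {ys} → Linked R (xs ++ ys) →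
               Linked R xs × Connected R (last xs) (head ys) × Linked R ys
  Linked-++⁻ []       {[]}     h = [] , nothing , h
  Linked-++⁻ []       {y ∷ ys} h = [] , nothing-just , h
  Linked-++⁻ (x ∷ []) {[]}     h = [-] , just-nothing , []
  Linked-++⁻ (x ∷ []) {y ∷ ys} h = [-] , just (Linked.head h) , Linked.tail h
  Linked-++⁻ (x ∷ xs@(_ ∷ _)) (r ∷ h) with Linked-++⁻ xs h
  ... | hxs , conn , hys = r ∷ hxs , conn , hys

module _ {R : Path → Path → Set} where

  adjacent⇒Linked : ∀ l n → length l ≡ suc n →
                    (∀ {i} → i < n → R (nth l i) (nth l (suc i))) → Linked R l
  adjacent⇒Linked (x ∷ [])     zero    _ _ = [-]
  adjacent⇒Linked (x ∷ y ∷ l) (suc n) e h =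
    h z<s ∷ adjacent⇒Linked (y ∷ l) n (suc-injective e) (λ i<n → h (s<s i<n))

  Linked⇒adjacent : ∀ l n → length l ≡ suc n → Linked R l →
                    ∀ {i} → i < n → R (nth l i) (nth l (suc i))
  Linked⇒adjacent (x ∷ y ∷ l) (suc n) e (r ∷ rs) {zero}  _         = r
  Linked⇒adjacent (x ∷ y ∷ l) (suc n) e (r ∷ rs) {suc i} (s<s i<n) =
    Linked⇒adjacent (y ∷ l) n (suc-injective e) rs i<n

-- Levels of a tree

mutual
  atDepth-length : ∀ d t → All (λ p → length p ≡ d) (atDepth d t)
  atDepth-length zero    t         = refl ∷ []
  atDepth-length (suc d) (node ts) = atDepthF-length d 0 ts

  atDepthF-length : ∀ d j ts → All (λ p → length p ≡ suc d) (atDepthF d j ts)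
  atDepthF-length d j []       = []
  atDepthF-length d j (t ∷ ts) =
    AllP.++⁺ (AllP.map⁺ (All.map (cong suc) (atDepth-length d t))) (atDepthF-length d (suc j) ts)

mutual
  atDepth-beyond : ∀ d t → depth t < d → atDepth d t ≡ []
  atDepth-beyond (suc d) (node ts) (s≤s h) = atDepthF-beyond d 0 ts h

  atDepthF-beyond : ∀ d j ts → depthF ts ≤ d → atDepthF d j ts ≡ []
  atDepthF-beyond d j []       _ = refl
  atDepthF-beyond d j (t ∷ ts) h
    rewrite atDepth-beyond d t (m⊔n≤o⇒m≤o (suc (depth t)) (depthF ts) h)
          | atDepthF-beyond d (suc j) ts (m⊔n≤o⇒n≤o (suc (depth t)) (depthF ts) h) = refl

mutual
  atDepth-nonEmpty : ∀ d t → d ≤ depth t → NonEmpty (atDepth d t)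
  atDepth-nonEmpty zero    t         _ = nonEmpty [] []
  atDepth-nonEmpty (suc d) (node ts) h = atDepthF-nonEmpty d 0 ts h

  atDepthF-nonEmpty : ∀ d j ts → suc d ≤ depthF ts → NonEmpty (atDepthF d j ts)
  atDepthF-nonEmpty d j (t ∷ ts) h with d ≤? depth t
  ... | yes d≤t = NonEmpty-++ˡ _ (NonEmpty-map (j ∷_) (atDepth-nonEmpty d t d≤t))
  ... | no  d≰t = NonEmpty-++ʳ (map (j ∷_) (atDepth d t))
    (atDepthF-nonEmpty d (suc j) ts (m≤n⊔o⇒n<m⇒m≤o (suc (depth t)) (depthF ts) h (s≤s (≰⇒> d≰t))))

atDepthF≡[]⇒depthF≤ : ∀ d j ts → atDepthF d j ts ≡ [] → depthF ts ≤ d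
atDepthF≡[]⇒depthF≤ d j ts e with depthF ts ≤? d
... | yes ts≤d = ts≤d
... | no  ts≰d with subst NonEmpty e (atDepthF-nonEmpty d j ts (≰⇒> ts≰d))
...   | ()

atDepthF-++-∷ : ∀ d j ls S rs → atDepthF d j (ls ++ S ∷ rs) ≡
  atDepthF d j ls ++ (map ((j + length ls) ∷_) (atDepth d S) ++ atDepthF d (suc (j + length ls)) rs)
atDepthF-++-∷ d j []       S rs rewrite +-identityʳ j = refl
atDepthF-++-∷ d j (l ∷ ls) S rs rewrite atDepthF-++-∷ d (suc j) ls S rs | +-suc j (length ls) =
  sym (++-assoc (map (j ∷_) (atDepth d l)) _ _)

InSubtrees : ℕ → ℕ → ℕ → Path → Set
InSubtrees j m d p = ∃ λ i → ∃ λ q → p ≡ i ∷ q × j ≤ i × i < m × length q ≡ d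

atDepthF-InSubtrees : ∀ d j ts → All (InSubtrees j (j + length ts) d) (atDepthF d j ts)
atDepthF-InSubtrees d j []       = []
atDepthF-InSubtrees d j (t ∷ ts) = AllP.++⁺
  (AllP.map⁺ (All.map (λ {p} e → j , p , refl , ≤-refl , j<j+1+n , e) (atDepth-length d t)))
  (All.map (λ { (i , q , e , j<i , i<m , l) → i , q , e , <⇒≤ j<i , subst (i <_) (sym (+-suc j (length ts))) i<m , l })
    (atDepthF-InSubtrees d (suc j) ts))
  where
    j<j+1+n : j < j + suc (length ts)
    j<j+1+n = subst (j <_) (sym (+-suc j (length ts))) (s≤s (m≤m+n j (length ts)))

map-∷-InSubtrees : ∀ k d S → All (InSubtrees k (suc k) d) (map (k ∷_) (atDepth d S))
map-∷-InSubtrees k d S =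
  AllP.map⁺ (All.map (λ {p} e → k , p , refl , ≤-refl , ≤-refl , e) (atDepth-length d S))

InSubtrees-pathDist : ∀ {j m d p j′ m′ d′ p′} → InSubtrees j m d p → InSubtrees j′ m′ d′ p′ →
                      m ≤ j′ ⊎ m′ ≤ j → pathDist p p′ ≡ suc d + suc d′
InSubtrees-pathDist (i , q , refl , j≤i , i<m , refl) (i′ , q′ , refl , j′≤i′ , i′<m′ , refl) disjoint =
  pathDist-∷-≢ q q′ (i≢i′ disjoint)
  where
    i≢i′ : _ ⊎ _ → i ≢ i′
    i≢i′ (inj₁ m≤j′) refl = <⇒≱ i<m (≤-trans m≤j′ j′≤i′)
    i≢i′ (inj₂ m′≤j) refl = <⇒≱ i′<m′ (≤-trans m′≤j j≤i)

levelsBelow : ℕ → Tree → List Path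
levelsBelow zero    t = []
levelsBelow (suc N) t = atDepth N t ++ levelsBelow N t

levelsFrom : ℕ → ℕ → Tree → List Path
levelsFrom a zero    t = []
levelsFrom a (suc N) t = levelsFrom (suc a) N t ++ atDepth a t

levelsBelow-+ : ∀ N a t → levelsBelow (N + a) t ≡ levelsFrom a N t ++ levelsBelow a t
levelsBelow-+ zero    a t = refl
levelsBelow-+ (suc N) a t = begin
  levelsBelow (suc N + a) t                         ≡⟨ cong (λ x → levelsBelow x t) (sym (+-suc N a)) ⟩
  levelsBelow (N + suc a) t                         ≡⟨ levelsBelow-+ N (suc a) t ⟩
  levelsFrom (suc a) N t ++ levelsBelow (suc a) t   ≡⟨ ++-assoc (levelsFrom (suc a) N t) _ _ ⟨
  levelsFrom a (suc N) t ++ levelsBelow a t         ∎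
  where open ≡-Reasoning

levelsBelow-length< : ∀ N t → All (λ p → length p < N) (levelsBelow N t)
levelsBelow-length< zero    t = []
levelsBelow-length< (suc N) t = AllP.++⁺ (All.map (λ e → s≤s (≤-reflexive e)) (atDepth-length N t))
                                          (All.map m≤n⇒m≤1+n (levelsBelow-length< N t))

labelOrder≡levelsBelow : ∀ t → labelOrder t ≡ levelsBelow (suc (depth t)) t
labelOrder≡levelsBelow t =
  trans (cong (λ ds → concat (map (λ d → atDepth d t) ds)) (reverse-upTo (suc (depth t))))
        (downFrom-levels (suc (depth t)))
  where
    downFrom-levels : ∀ N → concat (map (λ d → atDepth d t) (downFrom N)) ≡ levelsBelow N t
    downFrom-levels zero    = refl
    downFrom-levels (suc N) = cong (atDepth N t ++_) (downFrom-levels N)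

labelOrder-split : ∀ N a t → suc (depth t) ≡ N + a → labelOrder t ≡ levelsFrom a N t ++ levelsBelow a t
labelOrder-split N a t e =
  trans (labelOrder≡levelsBelow t) (trans (cong (λ x → levelsBelow x t) e) (levelsBelow-+ N a t))

levelsBelowF-length : ℕ → List Tree → ℕ
levelsBelowF-length N []       = 0
levelsBelowF-length N (t ∷ ts) = length (levelsBelow N t) + levelsBelowF-length N ts

levelsBelowF-length-zero : ∀ ts → levelsBelowF-length 0 ts ≡ 0
levelsBelowF-length-zero []       = refl
levelsBelowF-length-zero (t ∷ ts) = levelsBelowF-length-zero ts

length-atDepthF-∷ : ∀ d j t ts →
                    length (atDepthF d j (t ∷ ts)) ≡ length (atDepth d t) + length (atDepthF d (suc j) ts)
length-atDepthF-∷ d j t ts = trans (length-++ (map (j ∷_) (atDepth d t)))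
                                   (cong (_+ length (atDepthF d (suc j) ts)) (length-map (j ∷_) (atDepth d t)))

levelsBelowF-length-suc : ∀ N j ts →
                          levelsBelowF-length (suc N) ts ≡ length (atDepthF N j ts) + levelsBelowF-length N ts
levelsBelowF-length-suc N j []       = refl
levelsBelowF-length-suc N j (t ∷ ts)
  rewrite levelsBelowF-length-suc N (suc j) ts | length-atDepthF-∷ N j t ts
        | length-++ (atDepth N t) {levelsBelow N t}
  = interchange (length (atDepth N t)) (length (levelsBelow N t))
                (length (atDepthF N (suc j) ts)) (levelsBelowF-length N ts)
  where
    interchange : ∀ a b x y → (a + b) + (x + y) ≡ (a + x) + (b + y)
    interchange = solve-∀

length-levelsBelow-node : ∀ N ts → length (levelsBelow (suc N) (node ts)) ≡ suc (levelsBelowF-length N ts)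
length-levelsBelow-node zero    ts = cong suc (sym (levelsBelowF-length-zero ts))
length-levelsBelow-node (suc N) ts
  rewrite length-++ (atDepthF N 0 ts) {levelsBelow (suc N) (node ts)} | length-levelsBelow-node N ts
        | levelsBelowF-length-suc N 0 ts
  = +-suc (length (atDepthF N 0 ts)) (levelsBelowF-length N ts)

mutual
  length-levelsBelow : ∀ N t → depth t < N → length (levelsBelow N t) ≡ size t
  length-levelsBelow (suc N) (node ts) (s≤s h) =
    trans (length-levelsBelow-node N ts) (cong suc (levelsBelowF-length≡sizeF N ts h))

  levelsBelowF-length≡sizeF : ∀ N ts → depthF ts ≤ N → levelsBelowF-length N ts ≡ sizeF ts
  levelsBelowF-length≡sizeF N []       _ = refl
  levelsBelowF-length≡sizeF N (t ∷ ts) h =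
    cong₂ _+_ (length-levelsBelow N t (m⊔n≤o⇒m≤o (suc (depth t)) (depthF ts) h))
              (levelsBelowF-length≡sizeF N ts (m⊔n≤o⇒n≤o (suc (depth t)) (depthF ts) h))

length-labelOrder : ∀ t → length (labelOrder t) ≡ size t
length-labelOrder t rewrite labelOrder≡levelsBelow t = length-levelsBelow (suc (depth t)) t ≤-refl

-- Gluing along a spine

glue : (m : ℕ) → Vec Tree m → Vec Tree m → Tree → Tree
glue zero    []            []            M = M
glue (suc m) (node ls ∷ L) (node rs ∷ R) M = node (ls ++ glue m L R M ∷ rs)

size-glue : ∀ m L R M → size (glue m L R M) + m ≡ totalSize L + totalSize R + size M
size-glue zero    []            []            M = +-identityʳ (size M)
size-glue (suc m) (node ls ∷ L) (node rs ∷ R) M = begin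
  suc (sizeF (ls ++ G ∷ rs)) + suc m               ≡⟨ cong (λ x → suc x + suc m) (sizeF-++ ls (G ∷ rs)) ⟩
  suc (sizeF ls + (size G + sizeF rs)) + suc m     ≡⟨ shift (sizeF ls) (sizeF rs) (size G) m ⟩
  (size G + m) + suc (suc (sizeF ls + sizeF rs))   ≡⟨ cong (_+ suc (suc (sizeF ls + sizeF rs))) (size-glue m L R M) ⟩
  (totalSize L + totalSize R + size M) + suc (suc (sizeF ls + sizeF rs))
    ≡⟨ regroup (sizeF ls) (sizeF rs) (totalSize L) (totalSize R) (size M) ⟩
  (suc (sizeF ls) + totalSize L) + (suc (sizeF rs) + totalSize R) + size M ∎
  where
    open ≡-Reasoning
    G = glue m L R M
    shift : ∀ a b s m → suc (a + (s + b)) + suc m ≡ (s + m) + suc (suc (a + b))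
    shift = solve-∀
    regroup : ∀ a b x y z → x + y + z + suc (suc (a + b)) ≡ (suc a + x) + (suc b + y) + z
    regroup = solve-∀

-- Admissible trees

module Admissibility (g : ℕ) where

  f c : ℕ
  f = ⌊ g /2⌋
  c = ⌈ g /2⌉

  f+c≡g : f + c ≡ g
  f+c≡g = ⌊n/2⌋+⌈n/2⌉≡n g

  f≤c : f ≤ c
  f≤c = ⌊n/2⌋≤⌈n/2⌉ g

  c+c≤1+g : c + c ≤ suc g
  c+c≤1+g with ⌈n/2⌉≡⌊n/2⌋⊎1+⌊n/2⌋ g
  ... | inj₁ c≡f   = ≤-trans (≤-reflexive (trans (cong (_+ c) c≡f) f+c≡g)) (n≤1+n g)
  ... | inj₂ c≡1+f = ≤-reflexive (trans (cong (_+ c) c≡1+f) (cong suc f+c≡g))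

  1+g<1+c+1+c : suc g < suc c + suc c
  1+g<1+c+1+c = subst (λ x → suc x < suc c + suc c) f+c≡g
    (s≤s (≤-trans (s≤s (+-monoˡ-≤ c f≤c)) (≤-reflexive (sym (+-suc c c)))))

  1+g<1+c+1+f : suc g < suc c + suc f
  1+g<1+c+1+f = subst (λ x → suc x < suc c + suc f) f+c≡g
    (s≤s (≤-reflexive (trans (cong suc (+-comm f c)) (sym (+-suc c f)))))

  Close : Path → Path → Set
  Close p q = pathDist p q ≤ suc g

  Admissible : Tree → Set
  Admissible t = Linked Close (labelOrder t)

  close-short : ∀ p q → length p ≤ c → length q ≤ c → Close p q
  close-short p q p≤c q≤c = ≤-trans (pathDist≤length+length p q) (≤-trans (+-mono-≤ p≤c q≤c) c+c≤1+g)

  Linked-short : ∀ {ps} → All (λ p → length p ≤ c) ps → Linked Close ps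
  Linked-short []                       = []
  Linked-short (_ ∷ [])                 = [-]
  Linked-short {p ∷ q ∷ _} (hp ∷ hq ∷ hs) = close-short p q hp hq ∷ Linked-short (hq ∷ hs)

  Connected-short : ∀ {p} qs → length p ≤ c → All (λ q → length q ≤ c) qs →
                    Connected Close (just p) (head qs)
  Connected-short         []       _  _        = just-nothing
  Connected-short {p} (q ∷ _)  hp (hq ∷ _) = just (close-short p q hp hq)

  close-∷ : ∀ k {p q} → Close p q → Close (k ∷ p) (k ∷ q)
  close-∷ k {p} {q} = subst (_≤ suc g) (sym (pathDist-∷ k p q))

  close-∷⁻ : ∀ k {p q} → Close (k ∷ p) (k ∷ q) → Close p q
  close-∷⁻ k {p} {q} = subst (_≤ suc g) (pathDist-∷ k p q)

  shallow⇒admissible : ∀ t → depth t ≤ c → Admissible t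
  shallow⇒admissible t t≤c = subst (Linked Close) (sym (labelOrder≡levelsBelow t))
    (Linked-short (All.map (λ h → ≤-trans (≤-pred h) t≤c) (levelsBelow-length< (suc (depth t)) t)))

  Admissible⇒Linked-levelsBelow : ∀ a t → a ≤ suc (depth t) → Admissible t → Linked Close (levelsBelow a t)
  Admissible⇒Linked-levelsBelow a t a≤ adm =
    proj₂ (proj₂ (Linked-++⁻ (levelsFrom a N t) (subst (Linked Close) split adm)))
    where
      N = suc (depth t) ∸ a
      split = labelOrder-split N a t (sym (m∸n+n≡m a≤))

  -- The last element of X and the first of A lie in disjoint ranges of root subtrees,
  -- so they are at distance suc d₁ + suc d₂ > g + 1.
  Linked-far⇒[] : ∀ {j₁ m₁ d₁ j₂ m₂ d₂} X A rest → NonEmpty X →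
                  All (InSubtrees j₁ m₁ d₁) X → All (InSubtrees j₂ m₂ d₂) A → m₁ ≤ j₂ ⊎ m₂ ≤ j₁ →
                  suc g < suc d₁ + suc d₂ → Linked Close (X ++ (A ++ rest)) → A ≡ []
  Linked-far⇒[] X []      rest _  _  _        _        _   _      = refl
  Linked-far⇒[] X (a ∷ A) rest ne inX (inA ∷ _) disjoint far linked
    with Linked-++⁻ X linked | All-last inX ne
  ... | _ , conn , _ | x , last≡x , inX′ =
    ⊥-elim (<⇒≱ far (subst (_≤ suc g) (InSubtrees-pathDist inX′ inA disjoint)
                            (drop-just (subst (λ y → Connected Close y (just a)) last≡x conn))))

  module Spine (ls : List Tree) (S : Tree) (rs : List Tree)
               (hl : depthF ls ≤ c) (hr : depthF rs ≤ c) (hS : c ≤ depth S) where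

    T : Tree
    T = node (ls ++ S ∷ rs)

    k N : ℕ
    k = length ls
    N = depth S ∸ c

    depthT : depth T ≡ suc (depth S)
    depthT = depth-spine ls S rs hl hr hS

    atDepth-deep : ∀ d → c ≤ d → atDepth (suc d) T ≡ map (k ∷_) (atDepth d S)
    atDepth-deep d c≤d
      rewrite atDepthF-++-∷ d 0 ls S rs
            | atDepthF-beyond d 0 ls (≤-trans hl c≤d)
            | atDepthF-beyond d (suc k) rs (≤-trans hr c≤d) = ++-identityʳ _

    levelsFrom-deep : ∀ M a → c ≤ a → levelsFrom (suc a) M T ≡ map (k ∷_) (levelsFrom a M S)
    levelsFrom-deep zero    a c≤a = refl
    levelsFrom-deep (suc M) a c≤a
      rewrite levelsFrom-deep M (suc a) (m≤n⇒m≤1+n c≤a) | atDepth-deep a c≤a =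
      sym (map-++ (k ∷_) (levelsFrom (suc a) M S) (atDepth a S))

    depthS≡N+c : depth S ≡ N + c
    depthS≡N+c = sym (m∸n+n≡m hS)

    labelOrder-T : labelOrder T ≡ map (k ∷_) (levelsFrom c (suc N) S) ++ levelsBelow (suc c) T
    labelOrder-T = begin
      labelOrder T
        ≡⟨ labelOrder-split (suc N) (suc c) T depth-eq ⟩
      levelsFrom (suc c) (suc N) T ++ levelsBelow (suc c) T
        ≡⟨ cong (_++ levelsBelow (suc c) T) (levelsFrom-deep (suc N) c ≤-refl) ⟩
      map (k ∷_) (levelsFrom c (suc N) S) ++ levelsBelow (suc c) T ∎
      where
        open ≡-Reasoning
        depth-eq : suc (depth T) ≡ suc N + suc c
        depth-eq = cong suc (trans depthT (trans (cong suc depthS≡N+c) (sym (+-suc N c))))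

    labelOrder-S : labelOrder S ≡ levelsFrom c (suc N) S ++ levelsBelow c S
    labelOrder-S = labelOrder-split (suc N) c S (cong suc depthS≡N+c)

    last-levelsFrom : ∃ λ p → last (levelsFrom c (suc N) S) ≡ just p × length p ≡ c
    last-levelsFrom with All-last (atDepth-length c S) (atDepth-nonEmpty c S hS)
    ... | p , last≡p , p≡c =
      p , trans (last-++ (levelsFrom (suc c) N S) (atDepth-nonEmpty c S hS)) last≡p , p≡c

    admissible⇒admissible-S : Admissible T → Admissible S
    admissible⇒admissible-S adm = subst (Linked Close) (sym labelOrder-S) (LinkedP.++⁺ deep boundary shallow)
      where
        short : All (λ p → length p ≤ c) (levelsBelow c S)
        short = All.map <⇒≤ (levelsBelow-length< c S)
        deep : Linked Close (levelsFrom c (suc N) S)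
        deep = Linked.map (close-∷⁻ k)
                 (LinkedP.map⁻ (proj₁ (Linked-++⁻ _ (subst (Linked Close) labelOrder-T adm))))
        boundary : Connected Close (last (levelsFrom c (suc N) S)) (head (levelsBelow c S))
        boundary with last-levelsFrom
        ... | p , last≡p , p≡c rewrite last≡p = Connected-short (levelsBelow c S) (≤-reflexive p≡c) short
        shallow : Linked Close (levelsBelow c S)
        shallow = Linked-short short

    c≤depthT : c ≤ depth T
    c≤depthT = ≤-trans hS (<⇒≤ (depth<depth-node ls S rs))

    -- For even g every step from depth c + 1 to depth c has length ≤ 2c + 1 = g + 1; for odd g the
    -- first vertex of depth c lies in S, because the subtrees left of S have depth < f.
    boundary-close : depthF ls ≤ f → ∀ p → length p ≡ c →
                     Connected Close (just (k ∷ p)) (head (atDepth c T))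
    boundary-close lf p p≡c with ⌈n/2⌉≡⌊n/2⌋⊎1+⌊n/2⌋ g
    ... | inj₁ c≡f with All-head (atDepth-length c T) (atDepth-nonEmpty c T c≤depthT)
    ...   | q , head≡q , q≡c rewrite head≡q =
      just (≤-trans (pathDist≤length+length (k ∷ p) q)
                    (≤-reflexive (trans (cong₂ _+_ (cong suc p≡c) q≡c)
                                        (cong suc (trans (cong (_+ c) c≡f) f+c≡g)))))
    boundary-close lf p p≡c | inj₂ c≡1+f =
      subst (λ x → Connected Close (just (k ∷ p)) (head (atDepth x T))) (sym c≡1+f) odd
      where
        f≤depthS : f ≤ depth S
        f≤depthS = ≤-trans f≤c hS
        odd : Connected Close (just (k ∷ p)) (head (atDepth (suc f) T))
        odd rewrite atDepthF-++-∷ f 0 ls S rs | atDepthF-beyond f 0 ls lf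
                  | head-++ (atDepthF f (suc k) rs) (NonEmpty-map (k ∷_) (atDepth-nonEmpty f S f≤depthS))
          with atDepth f S | atDepth-length f S | atDepth-nonEmpty f S f≤depthS
        ... | q ∷ _ | q≡f ∷ _ | nonEmpty _ _ =
          just (close-∷ k (≤-trans (pathDist≤length+length p q)
                                   (≤-trans (≤-reflexive (trans (cong₂ _+_ p≡c q≡f) (trans (+-comm c f) f+c≡g)))
                                            (n≤1+n g))))

    admissible-S⇒admissible : depthF ls ≤ f → Admissible S → Admissible T
    admissible-S⇒admissible lf adm = subst (Linked Close) (sym labelOrder-T) (LinkedP.++⁺ deep boundary shallow)
      where
        deep : Linked Close (map (k ∷_) (levelsFrom c (suc N) S))
        deep = LinkedP.map⁺ (Linked.map (close-∷ k)
                              (proj₁ (Linked-++⁻ _ (subst (Linked Close) labelOrder-S adm))))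
        boundary : Connected Close (last (map (k ∷_) (levelsFrom c (suc N) S))) (head (levelsBelow (suc c) T))
        boundary with last-levelsFrom
        ... | p , last≡p , p≡c =
          subst₂ (Connected Close)
                 (sym (trans (last-map (k ∷_) (levelsFrom c (suc N) S)) (cong (Maybe.map (k ∷_)) last≡p)))
                 (sym (head-++ (levelsBelow c T) (atDepth-nonEmpty c T c≤depthT)))
                 (boundary-close lf p p≡c)
        shallow : Linked Close (levelsBelow (suc c) T)
        shallow = Linked-short (All.map ≤-pred (levelsBelow-length< (suc c) T))

  Admissible-spine⇒Linked-levelsBelow : ∀ ls S rs → c ≤ depth S → Admissible (node (ls ++ S ∷ rs)) →
                                        Linked Close (levelsBelow (suc (suc c)) (node (ls ++ S ∷ rs)))
  Admissible-spine⇒Linked-levelsBelow ls S rs hS =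
    Admissible⇒Linked-levelsBelow (suc (suc c)) (node (ls ++ S ∷ rs))
                                  (s≤s (≤-trans (s≤s hS) (depth<depth-node ls S rs)))

  right-shallow : ∀ ls S rs → depthF ls ≤ c → c ≤ depth S → Admissible (node (ls ++ S ∷ rs)) →
                  depthF rs ≤ c
  right-shallow ls S rs hl hS adm = atDepthF≡[]⇒depthF≤ c (suc k) rs
    (Linked-far⇒[] X (atDepthF c (suc k) rs) rest (NonEmpty-map (k ∷_) (atDepth-nonEmpty c S hS))
                   (map-∷-InSubtrees k c S) (atDepthF-InSubtrees c (suc k) rs) (inj₁ ≤-refl) 1+g<1+c+1+c linked)
    where
      T = node (ls ++ S ∷ rs)
      k = length ls
      X = map (k ∷_) (atDepth c S)
      rest = atDepth c T ++ levelsBelow c T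
      level : atDepth (suc c) T ≡ X ++ atDepthF c (suc k) rs
      level rewrite atDepthF-++-∷ c 0 ls S rs | atDepthF-beyond c 0 ls hl = refl
      linked : Linked Close (X ++ (atDepthF c (suc k) rs ++ rest))
      linked = subst (Linked Close) (trans (cong (_++ rest) level) (++-assoc X _ rest))
                     (Admissible-spine⇒Linked-levelsBelow ls S rs hS adm)

  left-shallow : ∀ ls S rs → depthF ls ≤ c → depthF rs ≤ c → c ≤ depth S → Admissible (node (ls ++ S ∷ rs)) →
                 depthF ls ≤ f
  left-shallow ls S rs hl hr hS adm with ⌈n/2⌉≡⌊n/2⌋⊎1+⌊n/2⌋ g
  ... | inj₁ c≡f   = subst (depthF ls ≤_) c≡f hl
  ... | inj₂ c≡1+f = atDepthF≡[]⇒depthF≤ f 0 ls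
    (Linked-far⇒[] X (atDepthF f 0 ls) _ (NonEmpty-map (k ∷_) (atDepth-nonEmpty c S hS))
                   (map-∷-InSubtrees k c S) (atDepthF-InSubtrees f 0 ls) (inj₂ ≤-refl) 1+g<1+c+1+f linked)
    where
      T = node (ls ++ S ∷ rs)
      k = length ls
      X = map (k ∷_) (atDepth c S)
      rest = levelsBelow c T
      linked-c : Linked Close (X ++ (atDepth c T ++ rest))
      linked-c = subst (λ xs → Linked Close (xs ++ (atDepth c T ++ rest)))
                       (Spine.atDepth-deep ls S rs hl hr hS c ≤-refl)
                       (Admissible-spine⇒Linked-levelsBelow ls S rs hS adm)
      linked : Linked Close (X ++ (atDepthF f 0 ls ++ (map (k ∷_) (atDepth f S) ++ atDepthF f (suc k) rs) ++ rest))
      linked = subst (λ xs → Linked Close (X ++ xs))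
                     (trans (cong (_++ rest) (atDepthF-++-∷ f 0 ls S rs)) (++-assoc (atDepthF f 0 ls) _ rest))
                     (subst (λ x → Linked Close (X ++ (atDepth x T ++ rest))) c≡1+f linked-c)

  SpineDecomposition : List Tree → Set
  SpineDecomposition ts = ∃ λ ls → ∃ λ S → ∃ λ rs →
    ts ≡ ls ++ S ∷ rs × depthF ls ≤ f × depthF rs ≤ c × c ≤ depth S × Admissible S

  spineDecomposition : ∀ ts → Admissible (node ts) → c < depthF ts → SpineDecomposition ts
  spineDecomposition ts adm c<ts with findSpine ts c<ts
  ... | ls , S , rs , refl , hl , hS = ls , S , rs , refl , left-shallow ls S rs hl hr hS adm , hr , hS ,
                                       Spine.admissible⇒admissible-S ls S rs hl hr hS adm
    where hr = right-shallow ls S rs hl hS adm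

  LeftTrees RightTrees : ∀ {m} → Vec Tree m → Set
  LeftTrees  = VAll.All (λ t → depth t ≤ f)
  RightTrees = VAll.All (λ t → depth t ≤ c)

  depth-glue : ∀ m L R M → LeftTrees L → RightTrees R → depth M ≡ c → depth (glue m L R M) ≡ m + c
  depth-glue zero    []            []            M _               _               M≡c = M≡c
  depth-glue (suc m) (node ls ∷ L) (node rs ∷ R) M (hl VAll.∷ hL) (hr VAll.∷ hR) M≡c =
    trans (depth-spine ls (glue m L R M) rs (≤-trans hl f≤c) hr (subst (c ≤_) (sym IH) (m≤n+m c m)))
          (cong suc IH)
    where IH = depth-glue m L R M hL hR M≡c

  depth≡c⇒MCond : ∀ m M → depth M ≡ c → MCond g m M
  depth≡c⇒MCond zero    M M≡c = ≤-reflexive M≡c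
  depth≡c⇒MCond (suc m) M M≡c = M≡c

  MCond⇒depth≡c : ∀ m L R M → MCond g m M → c ≤ depth (glue m L R M) → depth M ≡ c
  MCond⇒depth≡c zero    [] [] M M≤c c≤M = ≤-antisym M≤c c≤M
  MCond⇒depth≡c (suc m) L  R  M M≡c _   = M≡c

  c≤depth-glue : ∀ m L R M → LeftTrees L → RightTrees R → depth M ≡ c → c ≤ depth (glue m L R M)
  c≤depth-glue m L R M hL hR M≡c = subst (c ≤_) (sym (depth-glue m L R M hL hR M≡c)) (m≤n+m c m)

  glue-admissible : ∀ m L R M → LeftTrees L → RightTrees R → MCond g m M → Admissible (glue m L R M)
  glue-admissible zero    []            []            M _               _               M≤c =
    shallow⇒admissible M M≤c
  glue-admissible (suc m) (node ls ∷ L) (node rs ∷ R) M (hl VAll.∷ hL) (hr VAll.∷ hR) M≡c =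
    Spine.admissible-S⇒admissible ls (glue m L R M) rs (≤-trans hl f≤c) hr (c≤depth-glue m L R M hL hR M≡c)
      hl (glue-admissible m L R M hL hR (depth≡c⇒MCond m M M≡c))

  GlueData : Set
  GlueData = ∃ λ m → Vec Tree m × Vec Tree m × Tree

  glue-injective : ∀ m m′ L L′ R R′ M M′ →
                   LeftTrees L → RightTrees R → MCond g m M → LeftTrees L′ → RightTrees R′ → MCond g m′ M′ →
                   glue m L R M ≡ glue m′ L′ R′ M′ → _≡_ {A = GlueData} (m , L , R , M) (m′ , L′ , R′ , M′)
  glue-injective zero zero [] [] [] [] M M′ _ _ _ _ _ _ refl = refl
  glue-injective zero (suc m′) [] L′ [] R′ M M′ _ _ M≤c hL′ hR′ M′≡c refl =
    ⊥-elim (<⇒≱ (s≤s (m≤n+m c m′)) (subst (_≤ c) (depth-glue (suc m′) L′ R′ M′ hL′ hR′ M′≡c) M≤c))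
  glue-injective (suc m) zero L [] R [] M M′ hL hR M≡c _ _ M′≤c refl =
    ⊥-elim (<⇒≱ (s≤s (m≤n+m c m)) (subst (_≤ c) (depth-glue (suc m) L R M hL hR M≡c) M′≤c))
  glue-injective (suc m) (suc m′) (node ls ∷ L) (node ls′ ∷ L′) (node rs ∷ R) (node rs′ ∷ R′) M M′
                 (hl VAll.∷ hL) (hr VAll.∷ hR) M≡c (hl′ VAll.∷ hL′) (hr′ VAll.∷ hR′) M′≡c e
    with spine-unique ls (glue m L R M) rs ls′ (glue m′ L′ R′ M′) rs′ (≤-trans hl f≤c) (≤-trans hl′ f≤c)
                      (c≤depth-glue m L R M hL hR M≡c) (c≤depth-glue m′ L′ R′ M′ hL′ hR′ M′≡c) (node-injective e)
  ... | refl , G≡G′ , refl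
    with glue-injective m m′ L L′ R R′ M M′ hL hR (depth≡c⇒MCond m M M≡c) hL′ hR′ (depth≡c⇒MCond m′ M′ M′≡c)
                        G≡G′
  ...   | refl = refl

  Decomposition : Tree → Set
  Decomposition T = ∃ λ m → ∃ λ L → ∃ λ R → ∃ λ M →
    LeftTrees {m} L × RightTrees R × MCond g m M × glue m L R M ≡ T

  decompose : ∀ N T → depth T ≤ N → Admissible T → Decomposition T
  decompose N (node ts) _ adm with depthF ts ≤? c
  ... | yes ts≤c = 0 , [] , [] , node ts , VAll.[] , VAll.[] , ts≤c , refl
  decompose zero (node ts) ts≤0 adm | no ts≰c = ⊥-elim (ts≰c (≤-trans ts≤0 z≤n))
  decompose (suc N) (node ts) ts≤N adm | no ts≰c with spineDecomposition ts adm (≰⇒> ts≰c)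
  ... | ls , S , rs , refl , hl , hr , hS , admS
    with decompose N S (≤-pred (≤-trans (depth<depth-node ls S rs) ts≤N)) admS
  ...   | m , L , R , M , hL , hR , mc , refl =
    suc m , node ls ∷ L , node rs ∷ R , M , hl VAll.∷ hL , hr VAll.∷ hR , MCond⇒depth≡c m L R M mc hS , refl

  adjacent⇒Admissible : ∀ n T → size T ≡ suc n → All (λ i → dist T i (suc i) ≤ suc g) (upTo n) →
                        Admissible T
  adjacent⇒Admissible n T size≡ adjacent =
    adjacent⇒Linked (labelOrder T) n (trans (length-labelOrder T) size≡) (AllP.applyUpTo⁻ (λ i → i) n adjacent)

  Admissible⇒adjacent : ∀ n T → size T ≡ suc n → Admissible T →
                        All (λ i → dist T i (suc i) ≤ suc g) (upTo n)
  Admissible⇒adjacent n T size≡ adm =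
    AllP.applyUpTo⁺₁ (λ i → i) n (Linked⇒adjacent (labelOrder T) n (trans (length-labelOrder T) size≡) adm)

  MCond-irrelevant : ∀ m M → Irrelevant (MCond g m M)
  MCond-irrelevant zero    M = ≤-irrelevant
  MCond-irrelevant (suc m) M = ≡-irrelevant

  module _ (n : ℕ) where

    toTree : Quadruples n g → TreesND n g
    toTree (m , L , R , M , hL , hR , mc , sizes) =
      G , size≡ , Admissible⇒adjacent n G size≡ (glue-admissible m L R M hL hR mc)
      where
        G = glue m L R M
        size≡ : size G ≡ suc n
        size≡ = trans (+-cancelʳ-≡ m (size G) (n + 1) (trans (size-glue m L R M) sizes)) (+-comm n 1)

    Quadruples-≡ : ∀ {m L R M m′ L′ R′ M′} p p′ → _≡_ {A = GlueData} (m , L , R , M) (m′ , L′ , R′ , M′) →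
                   _≡_ {A = Quadruples n g} (m , L , R , M , p) (m′ , L′ , R′ , M′ , p′)
    Quadruples-≡ {m} {M = M} (hL , hR , mc , s) (hL′ , hR′ , mc′ , s′) refl
      rewrite VAll.irrelevant ≤-irrelevant hL hL′ | VAll.irrelevant ≤-irrelevant hR hR′
            | MCond-irrelevant m M mc mc′ | ≡-irrelevant s s′ = refl

    TreesND-≡ : ∀ {T} p p′ → _≡_ {A = TreesND n g} (T , p) (T , p′)
    TreesND-≡ (s , a) (s′ , a′) rewrite ≡-irrelevant s s′ | All.irrelevant ≤-irrelevant a a′ = refl

    toTree-injective : Injective _≡_ _≡_ toTree
    toTree-injective {m , L , R , M , hL , hR , mc , _} {m′ , L′ , R′ , M′ , hL′ , hR′ , mc′ , _} e =
      Quadruples-≡ _ _ (glue-injective m m′ L L′ R R′ M M′ hL hR mc hL′ hR′ mc′ (cong proj₁ e))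

    toTree-surjective : Surjective _≡_ _≡_ toTree
    toTree-surjective (T , size≡ , adjacent)
      with decompose (depth T) T ≤-refl (adjacent⇒Admissible n T size≡ adjacent)
    ... | m , L , R , M , hL , hR , mc , refl =
      (m , L , R , M , hL , hR , mc , sizes) , λ { refl → TreesND-≡ _ _ }
      where
        sizes : totalSize L + totalSize R + size M ≡ n + 1 + m
        sizes = trans (sym (size-glue m L R M)) (cong (_+ m) (trans size≡ (+-comm 1 n)))

lemma3p9 : (n g : ℕ) → TreesND n g ⤖ Quadruples n g
lemma3p9 n g = ⤖-sym (mk⤖ (toTree-injective n , toTree-surjective n))
  where open Admissibility g
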